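{- Every locally finite quasivariety of Wajsberg hoops is a primitive variety.
   Context: A Wajsberg hoop is a commutative integral residuated lattice $\langle A,\vee,\wedge,\cdot,\rightarrow,1\rangle$ satisfying $(x\rightarrow y)\vee(y\rightarrow x)\approx1$, $x(x\rightarrow y)\approx y(y\rightarrow x)$ and $(x\rightarrow y)\rightarrow y\approx(y\rightarrow x)\rightarrow x$. A quasivariety $\mathcal Q$ is primitive if every subquasivariety $\mathcal Q'\subseteq\mathcal Q$ is equational in $\mathcal Q$, i.e. $\mathcal Q'=\mathbf H(\mathcal Q')\cap\mathcal Q$, where $\mathbf H$ denotes closure under homomorphic images. -}

module Defs where

open import Level using (Level; 0ℓ; Lift) renaming (suc to lsuc)
open import Data.Nat using (ℕ)
open import Data.Fin using (Fin)
open import Data.List using (List)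
open import Data.List.Relation.Unary.All using (All)
open import Data.Product using (Σ; ∃; _×_; _,_)
open import Relation.Binary.Structures using (IsEquivalence)
open import Algebra.Core using (Op₂)
open import Algebra.Structures using (IsCommutativeMonoid)
open import Algebra.Lattice.Structures using (IsLattice)

record WHoop : Set₁ where
  infixr 6 _∨_
  infixr 7 _∧_
  infixr 8 _·_
  infixr 5 _⇒_
  infix 4 _≈_ _≤_
  field
    Carrier : Set
    _≈_     : Carrier → Carrier → Set
    _∨_ _∧_ _·_ _⇒_ : Op₂ Carrier
    𝟏       : Carrier
    isLattice   : IsLattice _≈_ _∨_ _∧_
    isCommMonoid : IsCommutativeMonoid _≈_ _·_ 𝟏
    ⇒-cong  : ∀ {x x′ y y′} → x ≈ x′ → y ≈ y′ → (x ⇒ y) ≈ (x′ ⇒ y′)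

  _≤_ : Carrier → Carrier → Set
  x ≤ y = (x ∧ y) ≈ x

  field
    integral    : ∀ x → x ≤ 𝟏
    residuation₁ : ∀ x y z → (x · y) ≤ z → x ≤ (y ⇒ z)
    residuation₂ : ∀ x y z → x ≤ (y ⇒ z) → (x · y) ≤ z
    prelinear   : ∀ x y → ((x ⇒ y) ∨ (y ⇒ x)) ≈ 𝟏
    divisible   : ∀ x y → (x · (x ⇒ y)) ≈ (y · (y ⇒ x))
    wajsberg    : ∀ x y → ((x ⇒ y) ⇒ y) ≈ ((y ⇒ x) ⇒ x)

data Term (V : Set) : Set where
  var  : V → Term V
  _∨ₜ_ _∧ₜ_ _·ₜ_ _⇒ₜ_ : Term V → Term V → Term V
  oneₜ : Term V

module _ (A : WHoop) where
  open WHoop A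

  ⟦_⟧ : ∀ {V} → Term V → (V → Carrier) → Carrier
  ⟦ var v ⟧ ρ = ρ v
  ⟦ s ∨ₜ t ⟧ ρ = ⟦ s ⟧ ρ ∨ ⟦ t ⟧ ρ
  ⟦ s ∧ₜ t ⟧ ρ = ⟦ s ⟧ ρ ∧ ⟦ t ⟧ ρ
  ⟦ s ·ₜ t ⟧ ρ = ⟦ s ⟧ ρ · ⟦ t ⟧ ρ
  ⟦ s ⇒ₜ t ⟧ ρ = ⟦ s ⟧ ρ ⇒ ⟦ t ⟧ ρ
  ⟦ oneₜ ⟧ ρ = 𝟏

Equation : Set
Equation = Term ℕ × Term ℕ

record QuasiIdentity : Set where
  constructor _⟹_
  field
    premises   : List Equation
    conclusion : Equation

_⊨ₑ_[_] : (A : WHoop) → Equation → (ℕ → WHoop.Carrier A) → Set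
A ⊨ₑ (s , t) [ ρ ] = WHoop._≈_ A (⟦ A ⟧ s ρ) (⟦ A ⟧ t ρ)

_⊨_ : WHoop → QuasiIdentity → Set
A ⊨ (ps ⟹ c) = ∀ (ρ : ℕ → WHoop.Carrier A) → All (λ e → A ⊨ₑ e [ ρ ]) ps → A ⊨ₑ c [ ρ ]

Class : Set₂
Class = WHoop → Set₁

_⊆_ : Class → Class → Set₁
K ⊆ L = ∀ A → K A → L A

_∩_ : Class → Class → Class
(K ∩ L) A = K A × L A

_≐_ : Class → Class → Set₁
K ≐ L = (K ⊆ L) × (L ⊆ K)

QISet : Set₁
QISet = QuasiIdentity → Set

Mod : QISet → Class
Mod Σ′ A = Lift (lsuc 0ℓ) (∀ q → Σ′ q → A ⊨ q)

record IsHom (A B : WHoop) (h : WHoop.Carrier A → WHoop.Carrier B) : Set where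
  private
    module A = WHoop A
    module B = WHoop B
  field
    cong   : ∀ {x y} → x A.≈ y → h x B.≈ h y
    hom-∨  : ∀ x y → h (x A.∨ y) B.≈ (h x B.∨ h y)
    hom-∧  : ∀ x y → h (x A.∧ y) B.≈ (h x B.∧ h y)
    hom-·  : ∀ x y → h (x A.· y) B.≈ (h x B.· h y)
    hom-⇒  : ∀ x y → h (x A.⇒ y) B.≈ (h x B.⇒ h y)
    hom-𝟏  : h A.𝟏 B.≈ B.𝟏

Surjective : (A B : WHoop) → (WHoop.Carrier A → WHoop.Carrier B) → Set
Surjective A B h = ∀ b → ∃ λ a → WHoop._≈_ B (h a) b

H : Class → Class
H K B = Σ WHoop λ A → K A × Σ (WHoop.Carrier A → WHoop.Carrier B) λ h →
          IsHom A B h × Surjective A B h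

IsFinite : WHoop → Set
IsFinite A = ∃ λ (n : ℕ) → Σ (Fin n → WHoop.Carrier A) λ f →
               ∀ a → ∃ λ i → WHoop._≈_ A (f i) a

FinitelyGenerated : WHoop → Set
FinitelyGenerated A = ∃ λ (n : ℕ) → Σ (Fin n → WHoop.Carrier A) λ g →
                        ∀ a → ∃ λ (t : Term (Fin n)) → WHoop._≈_ A (⟦ A ⟧ t g) a

LocallyFinite : Class → Set₁
LocallyFinite K = ∀ A → K A → FinitelyGenerated A → IsFinite A

IsQuasivariety : Class → Set₁
IsQuasivariety Q = Σ QISet λ Σ′ → Q ≐ Mod Σ′

-- A quasivariety is a variety iff it is closed under homomorphic images.
IsVariety : Class → Set₁
IsVariety Q = IsQuasivariety Q × (H Q ⊆ Q)

-- Q is primitive: every subquasivariety Q′ ⊆ Q is equational in Q.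
Primitive : Class → Set₂
Primitive Q = ∀ Q′ → IsQuasivariety Q′ → Q′ ⊆ Q → Q′ ≐ (H Q′ ∩ Q)

-- A subquasivariety Q′ of a locally finite quasivariety Q of Wajsberg hoops is closed under
-- homomorphic images; hence Q is a variety and every Q′ is equational in Q.  To push a
-- quasi-identity through a surjection h : A → B, lift a valuation satisfying the premises in B
-- to A and let u be the value of the conjunction of the biconditionals of the premises, so that
-- h u = 𝟏.  The subalgebra ⟨u⟩ lies in Q and is finitely generated, hence finite, so its minimum
-- e is idempotent, e ≤ u and h e = 𝟏.  For idempotent e the map e ⇒ _ is an endomorphism of A
-- that makes the premises hold exactly, so the conclusion holds after shifting the valuation by
-- e ⇒ _, and h forgets the shift because h e = 𝟏.
module Submission where

open import Defs
open import Level using (0ℓ; lift; lower)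
open import Data.Nat using (ℕ)
open import Data.Fin using (Fin; zero; suc)
open import Data.Product using (Σ; ∃; _×_; _,_; proj₁; proj₂)
open import Data.List using (List; []; _∷_)
open import Data.List.Relation.Unary.All using (All; []; _∷_)
import Data.List.Relation.Unary.All as All
open import Data.Vec.Functional using (foldr)
open import Function using (_∘_; id)
open import Algebra.Bundles.Raw using (RawMonoid)
open import Algebra.Lattice.Bundles.Raw using (RawLattice)
open import Algebra.Morphism.Structures using (module MonoidMorphisms)
open import Algebra.Lattice.Morphism.Structures using (IsLatticeMonomorphism)
import Algebra.Morphism.MonoidMonomorphism as MonoidMonomorphism
import Algebra.Lattice.Morphism.LatticeMonomorphism as LatticeMonomorphism
open import Algebra.Bundles using (CommutativeMonoid)
open import Algebra.Lattice.Bundles using (Lattice)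
import Algebra.Properties.CommutativeSemigroup as CommutativeSemigroupProperties
import Algebra.Lattice.Properties.Lattice as LatticeProperties
import Relation.Binary.Lattice as OrderLattice
import Relation.Binary.Reasoning.PartialOrder as ≤-Reasoning

module HoopProperties (A : WHoop) where
  -- The library's natural order x ≈ x ∧ y is WHoop._≤_ up to symmetry of ≈.
  open WHoop A public hiding (_≤_)

  lattice : Lattice 0ℓ 0ℓ
  lattice = record { isLattice = isLattice }

  commutativeMonoid : CommutativeMonoid 0ℓ 0ℓ
  commutativeMonoid = record { isCommutativeMonoid = isCommMonoid }

  open Lattice lattice public using (∨-comm; ∨-cong; ∧-cong)
  open LatticeProperties lattice public using (∧-idem; ∨-idem)
  open OrderLattice.Lattice (LatticeProperties.∨-∧-orderTheoreticLattice lattice) public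
    using (_≤_; poset; refl; reflexive; trans; antisym; x≤x∨y; y≤x∨y; ∨-least; x∧y≤x; x∧y≤y; ∧-greatest)
  open CommutativeMonoid commutativeMonoid public
    using (identityˡ; identityʳ) renaming (comm to ·-comm; assoc to ·-assoc; ∙-cong to ·-cong; ∙-congˡ to ·-congˡ; ∙-congʳ to ·-congʳ; refl to ≈-refl; sym to ≈-sym; trans to ≈-trans)
  open CommutativeSemigroupProperties (CommutativeMonoid.commutativeSemigroup commutativeMonoid) public
    using (interchange; xy∙z≈xz∙y)
  open ≤-Reasoning poset public

  x≤𝟏 : ∀ x → x ≤ 𝟏
  x≤𝟏 x = ≈-sym (integral x)

  ⇒-intro : ∀ {x y z} → x · y ≤ z → x ≤ y ⇒ z
  ⇒-intro xy≤z = ≈-sym (residuation₁ _ _ _ (≈-sym xy≤z))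

  ⇒-elim : ∀ {x y z} → x ≤ y ⇒ z → x · y ≤ z
  ⇒-elim x≤y⇒z = ≈-sym (residuation₂ _ _ _ (≈-sym x≤y⇒z))

  ⇒-mp : ∀ x y → (x ⇒ y) · x ≤ y
  ⇒-mp x y = ⇒-elim refl

  ·-monoˡ-≤ : ∀ z {x y} → x ≤ y → x · z ≤ y · z
  ·-monoˡ-≤ z x≤y = ⇒-elim (trans x≤y (⇒-intro refl))

  ·-monoʳ-≤ : ∀ z {x y} → x ≤ y → z · x ≤ z · y
  ·-monoʳ-≤ z {x} {y} x≤y = begin
    z · x  ≈⟨ ·-comm z x ⟩
    x · z  ≤⟨ ·-monoˡ-≤ z x≤y ⟩
    y · z  ≈⟨ ·-comm y z ⟩
    z · y  ∎

  ·-mono-≤ : ∀ {x x′ y y′} → x ≤ x′ → y ≤ y′ → x · y ≤ x′ · y′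
  ·-mono-≤ x≤x′ y≤y′ = trans (·-monoˡ-≤ _ x≤x′) (·-monoʳ-≤ _ y≤y′)

  x·y≤x : ∀ x y → x · y ≤ x
  x·y≤x x y = trans (·-monoʳ-≤ x (x≤𝟏 y)) (reflexive (identityʳ x))

  x·y≤y : ∀ x y → x · y ≤ y
  x·y≤y x y = trans (reflexive (·-comm x y)) (x·y≤x y x)

  x≤y⇒x : ∀ x y → x ≤ y ⇒ x
  x≤y⇒x x y = ⇒-intro (x·y≤x x y)

  ⇒-monoʳ-≤ : ∀ z {x y} → x ≤ y → z ⇒ x ≤ z ⇒ y
  ⇒-monoʳ-≤ z x≤y = ⇒-intro (trans (⇒-mp z _) x≤y)

  x≤y⇒x⇒y≈𝟏 : ∀ {x y} → x ≤ y → x ⇒ y ≈ 𝟏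
  x≤y⇒x⇒y≈𝟏 x≤y = antisym (x≤𝟏 _) (⇒-intro (trans (reflexive (identityˡ _)) x≤y))

  𝟏≤x⇒y⇒x≤y : ∀ {x y} → 𝟏 ≤ x ⇒ y → x ≤ y
  𝟏≤x⇒y⇒x≤y 𝟏≤x⇒y = trans (reflexive (≈-sym (identityˡ _))) (⇒-elim 𝟏≤x⇒y)

  x⇒x≈𝟏 : ∀ x → x ⇒ x ≈ 𝟏
  x⇒x≈𝟏 x = x≤y⇒x⇒y≈𝟏 refl

  x⇒𝟏≈𝟏 : ∀ x → x ⇒ 𝟏 ≈ 𝟏
  x⇒𝟏≈𝟏 x = x≤y⇒x⇒y≈𝟏 (x≤𝟏 x)

  𝟏⇒x≈x : ∀ x → 𝟏 ⇒ x ≈ x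
  𝟏⇒x≈x x = antisym (trans (reflexive (≈-sym (identityʳ _))) (⇒-mp 𝟏 x)) (x≤y⇒x x 𝟏)

  ⇒-curry : ∀ x y z → x · y ⇒ z ≈ x ⇒ (y ⇒ z)
  ⇒-curry x y z = antisym
    (⇒-intro (⇒-intro (trans (reflexive (·-assoc _ x y)) (⇒-mp (x · y) z))))
    (⇒-intro (trans (reflexive (≈-sym (·-assoc _ x y))) (⇒-elim (⇒-elim refl))))

  ·-distribˡ-∨-≤ : ∀ z x y → z · (x ∨ y) ≤ z · x ∨ z · y
  ·-distribˡ-∨-≤ z x y = trans (reflexive (·-comm z (x ∨ y))) (⇒-elim (∨-least
    (⇒-intro (trans (reflexive (·-comm x z)) (x≤x∨y _ _)))
    (⇒-intro (trans (reflexive (·-comm y z)) (y≤x∨y _ _)))))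

  ⇒-distribˡ-∧ : ∀ z x y → z ⇒ (x ∧ y) ≈ (z ⇒ x) ∧ (z ⇒ y)
  ⇒-distribˡ-∧ z x y = antisym
    (∧-greatest (⇒-monoʳ-≤ z (x∧y≤x x y)) (⇒-monoʳ-≤ z (x∧y≤y x y)))
    (⇒-intro (∧-greatest (trans (·-monoˡ-≤ z (x∧y≤x _ _)) (⇒-mp z x))
                         (trans (·-monoˡ-≤ z (x∧y≤y _ _)) (⇒-mp z y))))

  [x∨y]·[x⇒y]≤y : ∀ x y → (x ∨ y) · (x ⇒ y) ≤ y
  [x∨y]·[x⇒y]≤y x y = begin
    (x ∨ y) · (x ⇒ y)              ≈⟨ ·-comm _ _ ⟩
    (x ⇒ y) · (x ∨ y)              ≤⟨ ·-distribˡ-∨-≤ (x ⇒ y) x y ⟩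
    (x ⇒ y) · x ∨ (x ⇒ y) · y      ≤⟨ ∨-least (⇒-mp x y) (x·y≤y _ y) ⟩
    y                              ∎

  -- Prelinearity splits z ⇒ (x ∨ y) along the two cases x ⇒ y and y ⇒ x.
  ⇒-distribˡ-∨ : ∀ z x y → z ⇒ (x ∨ y) ≈ (z ⇒ x) ∨ (z ⇒ y)
  ⇒-distribˡ-∨ z x y = antisym ≤-∨ (∨-least (⇒-monoʳ-≤ z (x≤x∨y x y)) (⇒-monoʳ-≤ z (y≤x∨y x y)))
    where
    w = z ⇒ (x ∨ y)
    case : ∀ {c b} → (x ∨ y) · c ≤ b → w · c ≤ z ⇒ b
    case {c} {b} [x∨y]·c≤b = ⇒-intro (begin
      (w · c) · z  ≈⟨ xy∙z≈xz∙y w c z ⟩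
      (w · z) · c  ≤⟨ ·-monoˡ-≤ c (⇒-mp z (x ∨ y)) ⟩
      (x ∨ y) · c  ≤⟨ [x∨y]·c≤b ⟩
      b            ∎)
    [x∨y]·[y⇒x]≤x : (x ∨ y) · (y ⇒ x) ≤ x
    [x∨y]·[y⇒x]≤x = trans (reflexive (·-congʳ (∨-comm x y))) ([x∨y]·[x⇒y]≤y y x)
    ≤-∨ : w ≤ (z ⇒ x) ∨ (z ⇒ y)
    ≤-∨ = begin
      w                              ≈⟨ identityʳ w ⟨
      w · 𝟏                          ≈⟨ ·-congˡ (prelinear x y) ⟨
      w · ((x ⇒ y) ∨ (y ⇒ x))        ≤⟨ ·-distribˡ-∨-≤ w _ _ ⟩
      w · (x ⇒ y) ∨ w · (y ⇒ x)      ≤⟨ ∨-least (trans (case ([x∨y]·[x⇒y]≤y x y)) (y≤x∨y _ _))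
                                                (trans (case [x∨y]·[y⇒x]≤x) (x≤x∨y _ _)) ⟩
      (z ⇒ x) ∨ (z ⇒ y)              ∎

  ∏ : ∀ {n} → (Fin n → Carrier) → Carrier
  ∏ = foldr _·_ 𝟏

  ∏≤ : ∀ {n} (f : Fin n → Carrier) i → ∏ f ≤ f i
  ∏≤ f zero    = x·y≤x _ _
  ∏≤ f (suc i) = trans (x·y≤y _ _) (∏≤ (f ∘ suc) i)

  finite⇒minimum : IsFinite A → ∃ λ m → ∀ x → m ≤ x
  finite⇒minimum (n , f , onto) = ∏ f , λ x → trans (∏≤ f (proj₁ (onto x))) (reflexive (proj₂ (onto x)))

  minimum-idempotent : ∀ {m} → (∀ x → m ≤ x) → m · m ≈ m
  minimum-idempotent {m} m≤ = antisym (x·y≤x m m) (m≤ (m · m))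

  module Idempotent {e} (e·e≈e : e · e ≈ e) where

    x·e≈[x·e]·e : ∀ x → x · e ≈ (x · e) · e
    x·e≈[x·e]·e x = ≈-trans (·-congˡ (≈-sym e·e≈e)) (≈-sym (·-assoc x e e))

    e⇒[e⇒x]≈e⇒x : ∀ x → e ⇒ (e ⇒ x) ≈ e ⇒ x
    e⇒[e⇒x]≈e⇒x x = ≈-trans (≈-sym (⇒-curry e e x)) (⇒-cong e·e≈e ≈-refl)

    -- The Wajsberg identity enters only here: (p ⇒ e) ⇒ e ≈ (e ⇒ p) ⇒ p ≈ 𝟏 for p = e ⇒ x.
    e∨[e⇒x]≈𝟏 : ∀ x → e ∨ (e ⇒ x) ≈ 𝟏
    e∨[e⇒x]≈𝟏 x = antisym (x≤𝟏 _) (begin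
      𝟏                  ≈⟨ prelinear e p ⟨
      (e ⇒ p) ∨ (p ⇒ e)  ≤⟨ ∨-least (trans (reflexive (e⇒[e⇒x]≈e⇒x x)) (y≤x∨y e p))
                                   (trans [p⇒e]≤e (x≤x∨y e p)) ⟩
      e ∨ p              ∎)
      where
      p = e ⇒ x
      [p⇒e]⇒e≈𝟏 : (p ⇒ e) ⇒ e ≈ 𝟏
      [p⇒e]⇒e≈𝟏 = ≈-trans (wajsberg p e) (≈-trans (⇒-cong (e⇒[e⇒x]≈e⇒x x) ≈-refl) (x⇒x≈𝟏 p))
      [p⇒e]≤e : p ⇒ e ≤ e
      [p⇒e]≤e = 𝟏≤x⇒y⇒x≤y (reflexive (≈-sym [p⇒e]⇒e≈𝟏))

    x≤x·e∨x·[e⇒y] : ∀ x y → x ≤ x · e ∨ x · (e ⇒ y)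
    x≤x·e∨x·[e⇒y] x y = begin
      x                    ≈⟨ identityʳ x ⟨
      x · 𝟏                ≈⟨ ·-congˡ (e∨[e⇒x]≈𝟏 y) ⟨
      x · (e ∨ (e ⇒ y))    ≤⟨ ·-distribˡ-∨-≤ x e (e ⇒ y) ⟩
      x · e ∨ x · (e ⇒ y)  ∎

    e·x≈e·[e⇒x] : ∀ x → e · x ≈ e · (e ⇒ x)
    e·x≈e·[e⇒x] x = antisym (·-monoʳ-≤ e (x≤y⇒x x e)) (begin
      e · (e ⇒ x)        ≈⟨ ·-comm e _ ⟩
      (e ⇒ x) · e        ≈⟨ x·e≈[x·e]·e _ ⟩
      ((e ⇒ x) · e) · e  ≤⟨ ·-monoˡ-≤ e (⇒-mp e x) ⟩
      x · e              ≈⟨ ·-comm x e ⟩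
      e · x              ∎)

    e≤x⇒y⇒e⇒x≤e⇒y : ∀ {x y} → e ≤ x ⇒ y → e ⇒ x ≤ e ⇒ y
    e≤x⇒y⇒e⇒x≤e⇒y {x} {y} e≤x⇒y = ⇒-intro (begin
      (e ⇒ x) · e  ≈⟨ ·-comm _ e ⟩
      e · (e ⇒ x)  ≈⟨ e·x≈e·[e⇒x] x ⟨
      e · x        ≤⟨ ⇒-elim e≤x⇒y ⟩
      y            ∎)

    ⇒-distribˡ-· : ∀ x y → e ⇒ (x · y) ≈ (e ⇒ x) · (e ⇒ y)
    ⇒-distribˡ-· x y = antisym w≤a·b (⇒-intro (begin
      (a · b) · e            ≈⟨ ·-congˡ e·e≈e ⟨
      (a · b) · (e · e)      ≈⟨ interchange a b e e ⟩
      (a · e) · (b · e)      ≤⟨ ·-mono-≤ (⇒-mp e x) (⇒-mp e y) ⟩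
      x · y                  ∎))
      where
      a = e ⇒ x
      b = e ⇒ y
      w = e ⇒ (x · y)
      w·e≤a·b : w · e ≤ a · b
      w·e≤a·b = trans (⇒-mp e (x · y)) (·-mono-≤ (x≤y⇒x x e) (x≤y⇒x y e))
      w·a≤a·b : w · a ≤ a · b
      w·a≤a·b = begin
        w · a                    ≤⟨ x≤x·e∨x·[e⇒y] (w · a) y ⟩
        (w · a) · e ∨ (w · a) · b  ≤⟨ ∨-least (trans (reflexive (xy∙z≈xz∙y w a e)) (trans (x·y≤x _ a) w·e≤a·b))
                                               (·-monoˡ-≤ b (x·y≤y w a)) ⟩
        a · b                    ∎
      w≤a·b : w ≤ a · b
      w≤a·b = trans (x≤x·e∨x·[e⇒y] w x) (∨-least w·e≤a·b w·a≤a·b)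

    ⇒-distribˡ-⇒ : ∀ x y → e ⇒ (x ⇒ y) ≈ (e ⇒ x) ⇒ (e ⇒ y)
    ⇒-distribˡ-⇒ x y = begin-equality
      e ⇒ (x ⇒ y)          ≈⟨ ⇒-curry e x y ⟨
      e · x ⇒ y            ≈⟨ ⇒-cong (≈-trans (e·x≈e·[e⇒x] x) (·-comm e _)) ≈-refl ⟩
      (e ⇒ x) · e ⇒ y      ≈⟨ ⇒-curry (e ⇒ x) e y ⟩
      (e ⇒ x) ⇒ (e ⇒ y)    ∎

    e⇒-isHom : IsHom A A (e ⇒_)
    e⇒-isHom = record
      { cong  = ⇒-cong ≈-refl
      ; hom-∨ = ⇒-distribˡ-∨ e
      ; hom-∧ = ⇒-distribˡ-∧ e
      ; hom-· = ⇒-distribˡ-·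
      ; hom-⇒ = ⇒-distribˡ-⇒
      ; hom-𝟏 = x⇒𝟏≈𝟏 e
      }

module _ {A B : WHoop} {h : WHoop.Carrier A → WHoop.Carrier B} (h-isHom : IsHom A B h) where
  private
    module B = HoopProperties B
  open IsHom h-isHom

  ⟦⟧-hom : ∀ {V} (t : Term V) ρ → h (⟦ A ⟧ t ρ) B.≈ ⟦ B ⟧ t (h ∘ ρ)
  ⟦⟧-hom (var v)  ρ = B.≈-refl
  ⟦⟧-hom (s ∨ₜ t) ρ = B.≈-trans (hom-∨ _ _) (B.∨-cong (⟦⟧-hom s ρ) (⟦⟧-hom t ρ))
  ⟦⟧-hom (s ∧ₜ t) ρ = B.≈-trans (hom-∧ _ _) (B.∧-cong (⟦⟧-hom s ρ) (⟦⟧-hom t ρ))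
  ⟦⟧-hom (s ·ₜ t) ρ = B.≈-trans (hom-· _ _) (B.·-cong (⟦⟧-hom s ρ) (⟦⟧-hom t ρ))
  ⟦⟧-hom (s ⇒ₜ t) ρ = B.≈-trans (hom-⇒ _ _) (B.⇒-cong (⟦⟧-hom s ρ) (⟦⟧-hom t ρ))
  ⟦⟧-hom oneₜ     ρ = hom-𝟏

module _ (A : WHoop) where
  open HoopProperties A

  ⟦⟧-cong : ∀ {V} (t : Term V) {ρ σ : V → Carrier} → (∀ v → ρ v ≈ σ v) → ⟦ A ⟧ t ρ ≈ ⟦ A ⟧ t σ
  ⟦⟧-cong (var v)  ρ≈σ = ρ≈σ v
  ⟦⟧-cong (s ∨ₜ t) ρ≈σ = ∨-cong (⟦⟧-cong s ρ≈σ) (⟦⟧-cong t ρ≈σ)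
  ⟦⟧-cong (s ∧ₜ t) ρ≈σ = ∧-cong (⟦⟧-cong s ρ≈σ) (⟦⟧-cong t ρ≈σ)
  ⟦⟧-cong (s ·ₜ t) ρ≈σ = ·-cong (⟦⟧-cong s ρ≈σ) (⟦⟧-cong t ρ≈σ)
  ⟦⟧-cong (s ⇒ₜ t) ρ≈σ = ⇒-cong (⟦⟧-cong s ρ≈σ) (⟦⟧-cong t ρ≈σ)
  ⟦⟧-cong oneₜ     ρ≈σ = ≈-refl

  ⟦⟧-𝟏 : ∀ {V} (t : Term V) → ⟦ A ⟧ t (λ _ → 𝟏) ≈ 𝟏
  ⟦⟧-𝟏 (var v)  = ≈-refl
  ⟦⟧-𝟏 (s ∨ₜ t) = ≈-trans (∨-cong (⟦⟧-𝟏 s) (⟦⟧-𝟏 t)) (∨-idem 𝟏)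
  ⟦⟧-𝟏 (s ∧ₜ t) = ≈-trans (∧-cong (⟦⟧-𝟏 s) (⟦⟧-𝟏 t)) (∧-idem 𝟏)
  ⟦⟧-𝟏 (s ·ₜ t) = ≈-trans (·-cong (⟦⟧-𝟏 s) (⟦⟧-𝟏 t)) (identityʳ 𝟏)
  ⟦⟧-𝟏 (s ⇒ₜ t) = ≈-trans (⇒-cong (⟦⟧-𝟏 s) (⟦⟧-𝟏 t)) (x⇒x≈𝟏 𝟏)
  ⟦⟧-𝟏 oneₜ     = ≈-refl

-- The subalgebra generated by ρ, presented by terms over V modulo equality of their values.
module Generated (A : WHoop) {V : Set} (ρ : V → WHoop.Carrier A) where
  open HoopProperties A
  open MonoidMorphisms using (IsMonoidMonomorphism)

  ev : Term V → Carrier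
  ev t = ⟦ A ⟧ t ρ

  private
    termLattice : RawLattice 0ℓ 0ℓ
    termLattice = record { _≈_ = λ s t → ev s ≈ ev t ; _∧_ = _∧ₜ_ ; _∨_ = _∨ₜ_ }

    termMonoid : RawMonoid 0ℓ 0ℓ
    termMonoid = record { _≈_ = λ s t → ev s ≈ ev t ; _∙_ = _·ₜ_ ; ε = oneₜ }

    ev-isLatticeMonomorphism : IsLatticeMonomorphism termLattice (Lattice.rawLattice lattice) ev
    ev-isLatticeMonomorphism = record
      { isLatticeHomomorphism = record
        { isRelHomomorphism = record { cong = id }
        ; ∧-homo = λ _ _ → ≈-refl
        ; ∨-homo = λ _ _ → ≈-refl
        }
      ; injective = id
      }

    ev-isMonoidMonomorphism : IsMonoidMonomorphism termMonoid (CommutativeMonoid.rawMonoid commutativeMonoid) ev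
    ev-isMonoidMonomorphism = record
      { isMonoidHomomorphism = record
        { isMagmaHomomorphism = record
          { isRelHomomorphism = record { cong = id }
          ; homo = λ _ _ → ≈-refl
          }
        ; ε-homo = ≈-refl
        }
      ; injective = id
      }

  subalgebra : WHoop
  subalgebra = record
    { Carrier      = Term V
    ; _≈_          = λ s t → ev s ≈ ev t
    ; _∨_          = _∨ₜ_
    ; _∧_          = _∧ₜ_
    ; _·_          = _·ₜ_
    ; _⇒_          = _⇒ₜ_
    ; 𝟏            = oneₜ
    ; isLattice    = LatticeMonomorphism.isLattice ev-isLatticeMonomorphism isLattice
    ; isCommMonoid = MonoidMonomorphism.isCommutativeMonoid ev-isMonoidMonomorphism isCommMonoid
    ; ⇒-cong       = ⇒-cong
    ; integral     = λ x → integral (ev x)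
    ; residuation₁ = λ x y z → residuation₁ (ev x) (ev y) (ev z)
    ; residuation₂ = λ x y z → residuation₂ (ev x) (ev y) (ev z)
    ; prelinear    = λ x y → prelinear (ev x) (ev y)
    ; divisible    = λ x y → divisible (ev x) (ev y)
    ; wajsberg     = λ x y → wajsberg (ev x) (ev y)
    }

  ev-isHom : IsHom subalgebra A ev
  ev-isHom = record
    { cong  = id
    ; hom-∨ = λ _ _ → ≈-refl
    ; hom-∧ = λ _ _ → ≈-refl
    ; hom-· = λ _ _ → ≈-refl
    ; hom-⇒ = λ _ _ → ≈-refl
    ; hom-𝟏 = ≈-refl
    }

  ⊨⇒subalgebra-⊨ : ∀ q → A ⊨ q → subalgebra ⊨ q
  ⊨⇒subalgebra-⊨ (ps ⟹ (s , t)) A⊨q σ premises = begin-equality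
    ev (⟦ subalgebra ⟧ s σ)  ≈⟨ ⟦⟧-hom ev-isHom s σ ⟩
    ⟦ A ⟧ s (ev ∘ σ)         ≈⟨ A⊨q (ev ∘ σ) (All.map (λ {e} → premise e) premises) ⟩
    ⟦ A ⟧ t (ev ∘ σ)         ≈⟨ ⟦⟧-hom ev-isHom t σ ⟨
    ev (⟦ subalgebra ⟧ t σ)  ∎
    where
    premise : ∀ e → subalgebra ⊨ₑ e [ σ ] → A ⊨ₑ e [ ev ∘ σ ]
    premise (l , r) l≈r = ≈-trans (≈-sym (⟦⟧-hom ev-isHom l σ)) (≈-trans l≈r (⟦⟧-hom ev-isHom r σ))

  finite⇒idempotent-minimum : IsFinite subalgebra →
                              Σ (Term V) λ m → (ev m · ev m ≈ ev m) × (∀ t → ev m ≤ ev t)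
  finite⇒idempotent-minimum finite =
    let m , m≤ = S.finite⇒minimum finite in m , S.minimum-idempotent {m} m≤ , m≤
    where module S = HoopProperties subalgebra

finitelyGenerated : (A : WHoop) {n : ℕ} (ρ : Fin n → WHoop.Carrier A) → FinitelyGenerated (Generated.subalgebra A ρ)
finitelyGenerated A {n} ρ = n , var , λ t → t , ⟦⟧-hom (ev-isHom) t var
  where open Generated A ρ

_⇔ₜ_ : ∀ {V} → Term V → Term V → Term V
s ⇔ₜ t = (s ⇒ₜ t) ∧ₜ (t ⇒ₜ s)

premiseTerm : List Equation → Term ℕ
premiseTerm []             = oneₜ
premiseTerm ((s , t) ∷ ps) = (s ⇔ₜ t) ∧ₜ premiseTerm ps

module _ (A : WHoop) {ρ : ℕ → WHoop.Carrier A} where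
  open HoopProperties A

  premises⇒premiseTerm≈𝟏 : ∀ {ps} → All (λ e → A ⊨ₑ e [ ρ ]) ps → ⟦ A ⟧ (premiseTerm ps) ρ ≈ 𝟏
  premises⇒premiseTerm≈𝟏 []                  = ≈-refl
  premises⇒premiseTerm≈𝟏 (s≈t ∷ premises) = ≈-trans
    (∧-cong (≈-trans (∧-cong (x≤y⇒x⇒y≈𝟏 (reflexive s≈t)) (x≤y⇒x⇒y≈𝟏 (reflexive (≈-sym s≈t)))) (∧-idem 𝟏))
            (premises⇒premiseTerm≈𝟏 premises))
    (∧-idem 𝟏)

  module _ {e} (e·e≈e : e · e ≈ e) where
    open Idempotent e·e≈e

    ≤premiseTerm⇒premises : ∀ {ps} → e ≤ ⟦ A ⟧ (premiseTerm ps) ρ → All (λ eq → A ⊨ₑ eq [ (e ⇒_) ∘ ρ ]) ps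
    ≤premiseTerm⇒premises {[]}          _  = []
    ≤premiseTerm⇒premises {(s , t) ∷ ps} e≤ = (begin-equality
      ⟦ A ⟧ s ((e ⇒_) ∘ ρ)  ≈⟨ ⟦⟧-hom e⇒-isHom s ρ ⟨
      e ⇒ ⟦ A ⟧ s ρ         ≈⟨ antisym (e≤x⇒y⇒e⇒x≤e⇒y (trans e≤s⇔t (x∧y≤x _ _)))
                                       (e≤x⇒y⇒e⇒x≤e⇒y (trans e≤s⇔t (x∧y≤y _ _))) ⟩
      e ⇒ ⟦ A ⟧ t ρ         ≈⟨ ⟦⟧-hom e⇒-isHom t ρ ⟩
      ⟦ A ⟧ t ((e ⇒_) ∘ ρ)  ∎) ∷ ≤premiseTerm⇒premises (trans e≤ (x∧y≤y _ _))
      where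
      e≤s⇔t : e ≤ ⟦ A ⟧ (s ⇔ₜ t) ρ
      e≤s⇔t = trans e≤ (x∧y≤x _ _)

module _ {A B : WHoop} {h : WHoop.Carrier A → WHoop.Carrier B} (h-isHom : IsHom A B h) where
  private
    module A = HoopProperties A
  open HoopProperties B
  open IsHom h-isHom

  h[e⇒x]≈hx : ∀ {e} → h e ≈ 𝟏 → ∀ x → h (e A.⇒ x) ≈ h x
  h[e⇒x]≈hx {e} he≈𝟏 x = begin-equality
    h (e A.⇒ x)  ≈⟨ hom-⇒ e x ⟩
    h e ⇒ h x    ≈⟨ ⇒-cong he≈𝟏 ≈-refl ⟩
    𝟏 ⇒ h x      ≈⟨ 𝟏⇒x≈x (h x) ⟩
    h x          ∎

  image-⊨ : Surjective A B h → (∀ u → IsFinite (Generated.subalgebra A (λ (_ : Fin 1) → u))) →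
            ∀ q → A ⊨ q → B ⊨ q
  image-⊨ h-onto finite (ps ⟹ (s , t)) A⊨q ρ premises = begin-equality
    ⟦ B ⟧ s ρ            ≈⟨ back s ⟨
    h (⟦ A ⟧ s ρ″)       ≈⟨ cong (A⊨q ρ″ (≤premiseTerm⇒premises A e·e≈e e≤u)) ⟩
    h (⟦ A ⟧ t ρ″)       ≈⟨ back t ⟩
    ⟦ B ⟧ t ρ            ∎
    where
    ρ′ : ℕ → A.Carrier
    ρ′ = proj₁ ∘ h-onto ∘ ρ
    h⟦⟧ρ′ : ∀ l → h (⟦ A ⟧ l ρ′) ≈ ⟦ B ⟧ l ρ
    h⟦⟧ρ′ l = ≈-trans (⟦⟧-hom h-isHom l ρ′) (⟦⟧-cong B l (proj₂ ∘ h-onto ∘ ρ))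
    u = ⟦ A ⟧ (premiseTerm ps) ρ′
    hu≈𝟏 : h u ≈ 𝟏
    hu≈𝟏 = ≈-trans (h⟦⟧ρ′ (premiseTerm ps)) (premises⇒premiseTerm≈𝟏 B premises)
    open Generated A (λ _ → u) using (ev; finite⇒idempotent-minimum)
    minimum = finite⇒idempotent-minimum (finite u)
    m = proj₁ minimum
    e = ev m
    e·e≈e = proj₁ (proj₂ minimum)
    e≤u = proj₂ (proj₂ minimum) (var zero)
    he≈𝟏 : h e ≈ 𝟏
    he≈𝟏 = ≈-trans (⟦⟧-hom h-isHom m _) (≈-trans (⟦⟧-cong B m (λ _ → hu≈𝟏)) (⟦⟧-𝟏 B m))
    ρ″ = (e A.⇒_) ∘ ρ′
    back : ∀ l → h (⟦ A ⟧ l ρ″) ≈ ⟦ B ⟧ l ρ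
    back l = begin-equality
      h (⟦ A ⟧ l ρ″)       ≈⟨ cong (⟦⟧-hom (A.Idempotent.e⇒-isHom e·e≈e) l ρ′) ⟨
      h (e A.⇒ ⟦ A ⟧ l ρ′) ≈⟨ h[e⇒x]≈hx he≈𝟏 _ ⟩
      h (⟦ A ⟧ l ρ′)       ≈⟨ h⟦⟧ρ′ l ⟩
      ⟦ B ⟧ l ρ            ∎

id-isHom : (A : WHoop) → IsHom A A id
id-isHom A = record
  { cong  = id
  ; hom-∨ = λ _ _ → ≈-refl
  ; hom-∧ = λ _ _ → ≈-refl
  ; hom-· = λ _ _ → ≈-refl
  ; hom-⇒ = λ _ _ → ≈-refl
  ; hom-𝟏 = ≈-refl
  }
  where open HoopProperties A

⊆H : ∀ K → K ⊆ H K
⊆H K A KA = A , KA , id , id-isHom A , λ a → a , HoopProperties.≈-refl A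

subalgebra-Mod : ∀ {Σ′} A {V} (ρ : V → WHoop.Carrier A) → Mod Σ′ A → Mod Σ′ (Generated.subalgebra A ρ)
subalgebra-Mod A ρ (lift A⊨Σ′) = lift λ q q∈Σ′ → Generated.⊨⇒subalgebra-⊨ A ρ q (A⊨Σ′ q q∈Σ′)

H-closed : ∀ {Q′ Q Σ′} → Q′ ≐ Mod Σ′ → Q′ ⊆ Q → LocallyFinite Q → H Q′ ⊆ Q′
H-closed (Q′⊆Mod , Mod⊆Q′) Q′⊆Q locallyFinite B (A , Q′A , h , h-isHom , h-onto) =
  Mod⊆Q′ B (lift λ q q∈Σ′ → image-⊨ h-isHom h-onto ⟨u⟩-finite q (lower A∈Mod q q∈Σ′))
  where
  A∈Mod = Q′⊆Mod A Q′A
  ⟨u⟩-finite : ∀ u → IsFinite (Generated.subalgebra A (λ (_ : Fin 1) → u))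
  ⟨u⟩-finite u = locallyFinite ⟨u⟩ (Q′⊆Q ⟨u⟩ (Mod⊆Q′ ⟨u⟩ (subalgebra-Mod A ρ A∈Mod))) (finitelyGenerated A ρ)
    where
    ρ : Fin 1 → WHoop.Carrier A
    ρ _ = u
    ⟨u⟩ = Generated.subalgebra A ρ

theorem4p4 : (Q : Class) → IsQuasivariety Q → LocallyFinite Q → IsVariety Q × Primitive Q
theorem4p4 Q (Σ′ , Q≐Mod) locallyFinite = ((Σ′ , Q≐Mod) , H-closed Q≐Mod (λ _ → id) locallyFinite) , isPrimitive
  where
  isPrimitive : Primitive Q
  isPrimitive Q′ (Σ″ , Q′≐Mod) Q′⊆Q =
    (λ A Q′A → ⊆H Q′ A Q′A , Q′⊆Q A Q′A) , λ A (HQ′A , _) → H-closed Q′≐Mod Q′⊆Q locallyFinite A HQ′A
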